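{- Let $\mathbf{u}$ be a recurrent infinite word over a finite alphabet, let $n\in\mathbb{N}$, and let $B\ge n$ be an integer such that the prefix $\mathbf{u}_{[B]}$ contains every factor of $\mathbf{u}$ of length $n$ and both begins and ends with $\mathbf{u}_{[n]}$. Then a word $w$ is a factor of $\mathbf{u}$ of length $n$ if and only if $w=x^{ -1}\mathbf{u}_{[n]}y$, where $x$ is a prefix of $\mathbf{u}_{[B]}\mathbf{u}_{[n]}^{ -1}$, $y$ is a prefix of $\mathbf{u}_{[n]}^{ -1}\mathbf{u}_{[B]}$, and $|x|=|y|$.
   Context: An infinite word is recurrent if each of its factors occurs in it infinitely often. $\mathbf{u}_{[n]}$ denotes the prefix of $\mathbf{u}$ of length $n$. For finite words: if $v=xv'$ then $x^{ -1}v:=v'$, and if $v=v'x$ then $vx^{ -1}:=v'$. (In the statement, $x$ is automatically a prefix of $\mathbf{u}_{[n]}y$, so $x^{ -1}\mathbf{u}_{[n]}y$ is the word obtained from $\mathbf{u}_{[n]}y$ by deleting its prefix $x$.) Such an integer $B$ always exists for recurrent $\mathbf{u}$. -}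

module Defs where

open import Data.Nat using (ℕ; zero; suc; _+_; _≤_)
open import Data.Fin using (Fin)
open import Data.List using (List; []; _∷_; _++_; length)
open import Data.Product using (Σ; ∃; _×_; _,_)
open import Relation.Binary.PropositionalEquality using (_≡_)

InfWord : ℕ → Set
InfWord k = ℕ → Fin k

factorAt : ∀ {k} → InfWord k → ℕ → ℕ → List (Fin k)
factorAt u i zero    = []
factorAt u i (suc m) = u i ∷ factorAt u (suc i) m

pref : ∀ {k} → InfWord k → ℕ → List (Fin k)
pref u n = factorAt u 0 n

IsFactor : ∀ {k} → List (Fin k) → InfWord k → Set
IsFactor {k} w u = ∃ λ i → w ≡ factorAt u i (length w)

IsPrefixOf : ∀ {k} → List (Fin k) → List (Fin k) → Set
IsPrefixOf {k} x v = ∃ λ (z : List (Fin k)) → x ++ z ≡ v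

IsSuffixOf : ∀ {k} → List (Fin k) → List (Fin k) → Set
IsSuffixOf {k} x v = ∃ λ (z : List (Fin k)) → z ++ x ≡ v

IsFactorOf : ∀ {k} → List (Fin k) → List (Fin k) → Set
IsFactorOf {k} w v = ∃ λ (p : List (Fin k)) → ∃ λ (s : List (Fin k)) → p ++ w ++ s ≡ v

Recurrent : ∀ {k} → InfWord k → Set
Recurrent u = ∀ i m N → ∃ λ j → (N ≤ j) × (factorAt u j m ≡ factorAt u i m)

module Submission where

-- Both directions reduce to bookkeeping about factors of u inside u[B]:
--   * a word b with  a ++ b ++ c = factorAt u i m  is the factor of u at
--     position i + |a| (lemmas prefix-factorAt, infix-factorAt);
--   * every shorter factor at the same position is a prefix of it
--     (factorAt-prefix-≤), which yields the prefix lemmas for the two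
--     complements u[B]u[n]⁻¹ and u[n]⁻¹u[B] (head-prefix, tail-prefix).
-- (⇒) A factor w of length n occurs in u[B] at some position p ≤ B − n;
--     take x = u[p] and y = the factor of length p at position n; then
--     x w = u[p + n] = u[n] y (concat-two-ways).
-- (⇐) From x w = u[n] y and y a prefix of u[n]⁻¹u[B] we get x w z = u[B],
--     so w occurs at position |x|, and |w| = n by counting lengths.
-- Recurrence and n ≤ B only serve to guarantee that such a B exists; the
-- characterisation itself does not need them.

open import Defs
open import Data.Nat using (ℕ; zero; suc; _+_; _∸_; _≤_)
open import Data.Nat.Properties
  using (+-suc; +-identityʳ; +-comm; +-cancelˡ-≡; +-cancelʳ-≤; +-cancelˡ-≤; m+[n∸m]≡n)
open import Data.Fin using (Fin)
open import Data.List using (List; []; _∷_; _++_; length)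
open import Data.List.Properties using (length-++; length-++-≤ˡ; ++-assoc; ++-identityʳ; ∷-injective)
open import Data.Product using (∃; _×_; _,_)
open import Function.Bundles using (_⇔_; mk⇔)
open import Relation.Binary.PropositionalEquality
open ≡-Reasoning

module _ {A : Set} where

  occurrence-end-≤ : ∀ (p w s t : List A) → p ++ w ++ s ≡ t → length p + length w ≤ length t
  occurrence-end-≤ p w s t e = subst₂ _≤_ (length-++ p) lengths (length-++-≤ˡ (p ++ w))
    where
    lengths : length ((p ++ w) ++ s) ≡ length t
    lengths = cong length (trans (++-assoc p w s) e)

  balanced-length : ∀ (x w P y : List A) → x ++ w ≡ P ++ y → length x ≡ length y
                  → length w ≡ length P
  balanced-length x w P y e lxy = +-cancelˡ-≡ (length x) (length w) (length P) (begin
    length x + length w ≡⟨ length-++ x ⟨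
    length (x ++ w)     ≡⟨ cong length e ⟩
    length (P ++ y)     ≡⟨ length-++ P ⟩
    length P + length y ≡⟨ cong (length P +_) lxy ⟨
    length P + length x ≡⟨ +-comm (length P) (length x) ⟩
    length x + length P ∎)

module _ {k : ℕ} (u : InfWord k) where

  length-factorAt : ∀ i m → length (factorAt u i m) ≡ m
  length-factorAt i zero    = refl
  length-factorAt i (suc m) = cong suc (length-factorAt (suc i) m)

  split-length : ∀ (v c : List (Fin k)) i m → v ++ c ≡ factorAt u i m → length v + length c ≡ m
  split-length v c i m e = trans (sym (length-++ v)) (trans (cong length e) (length-factorAt i m))

  factorAt-+ : ∀ i a d → factorAt u i (a + d) ≡ factorAt u i a ++ factorAt u (i + a) d
  factorAt-+ i zero    d = cong (λ j → factorAt u j d) (sym (+-identityʳ i))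
  factorAt-+ i (suc a) d = cong (u i ∷_) (begin
    factorAt u (suc i) (a + d)                          ≡⟨ factorAt-+ (suc i) a d ⟩
    factorAt u (suc i) a ++ factorAt u (suc i + a) d    ≡⟨ cong (λ j → factorAt u (suc i) a ++ factorAt u j d) (+-suc i a) ⟨
    factorAt u (suc i) a ++ factorAt u (i + suc a) d    ∎)

  concat-two-ways : ∀ i a b → factorAt u i a ++ factorAt u (i + a) b ≡ factorAt u i b ++ factorAt u (i + b) a
  concat-two-ways i a b = begin
    factorAt u i a ++ factorAt u (i + a) b ≡⟨ factorAt-+ i a b ⟨
    factorAt u i (a + b)                   ≡⟨ cong (factorAt u i) (+-comm a b) ⟩
    factorAt u i (b + a)                   ≡⟨ factorAt-+ i b a ⟩
    factorAt u i b ++ factorAt u (i + b) a ∎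

  prefix-factorAt : ∀ (b c : List (Fin k)) i m → b ++ c ≡ factorAt u i m → b ≡ factorAt u i (length b)
  prefix-factorAt []      c i m       e = refl
  prefix-factorAt (x ∷ b) c i (suc m) e with ∷-injective e
  ... | refl , e′ = cong (u i ∷_) (prefix-factorAt b c (suc i) m e′)

  infix-factorAt : ∀ (a b c : List (Fin k)) i m → a ++ b ++ c ≡ factorAt u i m
                 → b ≡ factorAt u (i + length a) (length b)
  infix-factorAt []      b c i m e =
    trans (prefix-factorAt b c i m e) (cong (λ j → factorAt u j (length b)) (sym (+-identityʳ i)))
  infix-factorAt (x ∷ a) b c i (suc m) e with ∷-injective e
  ... | refl , e′ = trans (infix-factorAt a b c (suc i) m e′)
                          (cong (λ j → factorAt u j (length b)) (sym (+-suc i (length a))))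

  factorAt-prefix-≤ : ∀ i a b → a ≤ b → IsPrefixOf (factorAt u i a) (factorAt u i b)
  factorAt-prefix-≤ i a b a≤b = factorAt u (i + a) (b ∸ a) ,
    trans (sym (factorAt-+ i a (b ∸ a))) (cong (factorAt u i) (m+[n∸m]≡n a≤b))

  head-prefix : ∀ (v c : List (Fin k)) i m a → v ++ c ≡ factorAt u i m → a + length c ≤ m
              → IsPrefixOf (factorAt u i a) v
  head-prefix v c i m a e fits =
    subst (IsPrefixOf (factorAt u i a)) (sym (prefix-factorAt v c i m e))
          (factorAt-prefix-≤ i a (length v) (+-cancelʳ-≤ (length c) a (length v) fits′))
    where
    fits′ : a + length c ≤ length v + length c
    fits′ = subst (a + length c ≤_) (sym (split-length v c i m e)) fits

  tail-prefix : ∀ (c v′ : List (Fin k)) i m a → c ++ v′ ≡ factorAt u i m → length c + a ≤ m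
              → IsPrefixOf (factorAt u (i + length c) a) v′
  tail-prefix c v′ i m a e fits =
    subst (IsPrefixOf (factorAt u (i + length c) a)) (sym v′-factor)
          (factorAt-prefix-≤ (i + length c) a (length v′) (+-cancelˡ-≤ (length c) a (length v′) fits′))
    where
    v′-factor : v′ ≡ factorAt u (i + length c) (length v′)
    v′-factor = infix-factorAt c v′ [] i m (trans (cong (c ++_) (++-identityʳ v′)) e)
    fits′ : length c + a ≤ length c + length v′
    fits′ = subst (length c + a ≤_) (sym (split-length c v′ i m e)) fits

SlidingWindow : ∀ {k} → InfWord k → ℕ → ℕ → List (Fin k) → Set
SlidingWindow {k} u n B w =
  ∃ λ (x : List (Fin k)) → ∃ λ (y : List (Fin k))
    → (∃ λ (v : List (Fin k)) → (v ++ pref u n ≡ pref u B) × IsPrefixOf x v)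
    × (∃ λ (v′ : List (Fin k)) → (pref u n ++ v′ ≡ pref u B) × IsPrefixOf y v′)
    × (length x ≡ length y)
    × (x ++ w ≡ pref u n ++ y)

-- (⇒) A factor of length n sitting at position p of u[B] is u[p]⁻¹ u[n] y, |y| = p.
factor⇒window : ∀ {k} (u : InfWord k) (n B : ℕ)
  → (∀ (w : List (Fin k)) → IsFactor w u → length w ≡ n → IsFactorOf w (pref u B))
  → IsPrefixOf (pref u n) (pref u B) → IsSuffixOf (pref u n) (pref u B)
  → ∀ (w : List (Fin k)) → IsFactor w u × length w ≡ n → SlidingWindow u n B w
factor⇒window u n B covers (v′ , P≺W) (v , W≻P) w (w-factor , lw)
  with covers w w-factor lw
... | p , s , e = p , y , (v , W≻P , x≺v) , (v′ , P≺W , y≺v′) , sym (length-factorAt u n (length p)) , window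
  where
  y = factorAt u n (length p)
  lenP : length (pref u n) ≡ n
  lenP = length-factorAt u 0 n
  p-prefix : p ≡ pref u (length p)
  p-prefix = prefix-factorAt u p (w ++ s) 0 B e
  w-factor′ : w ≡ factorAt u (length p) n
  w-factor′ = trans (infix-factorAt u p w s 0 B e) (cong (factorAt u (length p)) lw)
  fits : length p + n ≤ B
  fits = subst₂ (λ l m → length p + l ≤ m) lw (length-factorAt u 0 B) (occurrence-end-≤ p w s (pref u B) e)
  x≺v : IsPrefixOf p v
  x≺v = subst (λ q → IsPrefixOf q v) (sym p-prefix)
          (head-prefix u v (pref u n) 0 B (length p) W≻P (subst (λ l → length p + l ≤ B) (sym lenP) fits))
  y≺v′ : IsPrefixOf y v′
  y≺v′ = subst (λ j → IsPrefixOf (factorAt u j (length p)) v′) lenP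
           (tail-prefix u (pref u n) v′ 0 B (length p) P≺W
              (subst (λ l → l + length p ≤ B) (sym lenP) (subst (_≤ B) (+-comm (length p) n) fits)))
  window : p ++ w ≡ pref u n ++ y
  window = trans (cong₂ _++_ p-prefix w-factor′) (concat-two-ways u 0 (length p) n)

-- (⇐) If x w = u[n] y with y z = u[n]⁻¹u[B], then w occurs in u[B] at position |x|.
window⇒factor : ∀ {k} (u : InfWord k) (n B : ℕ) (w : List (Fin k))
  → SlidingWindow u n B w → IsFactor w u × length w ≡ n
window⇒factor u n B w (x , y , _ , (v′ , P≺W , (z , y≺v′)) , lxy , window) =
  (length x , infix-factorAt u x w z 0 B occurrence) ,
  trans (balanced-length x w (pref u n) y window lxy) (length-factorAt u 0 n)
  where
  occurrence : x ++ w ++ z ≡ pref u B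
  occurrence = begin
    x ++ w ++ z          ≡⟨ ++-assoc x w z ⟨
    (x ++ w) ++ z        ≡⟨ cong (_++ z) window ⟩
    (pref u n ++ y) ++ z ≡⟨ ++-assoc (pref u n) y z ⟩
    pref u n ++ y ++ z   ≡⟨ cong (pref u n ++_) y≺v′ ⟩
    pref u n ++ v′       ≡⟨ P≺W ⟩
    pref u B             ∎

proposition3p2 : ∀ {k : ℕ} (u : InfWord k) → Recurrent u → (n B : ℕ) → n ≤ B
    → (∀ (w : List (Fin k)) → IsFactor w u → length w ≡ n → IsFactorOf w (pref u B))
    → IsPrefixOf (pref u n) (pref u B)
    → IsSuffixOf (pref u n) (pref u B)
    → ∀ (w : List (Fin k))
    → ((IsFactor w u × length w ≡ n)
    ⇔ (∃ λ (x : List (Fin k)) → ∃ λ (y : List (Fin k))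
    → (∃ λ (v : List (Fin k)) → (v ++ pref u n ≡ pref u B) × IsPrefixOf x v)
    × (∃ λ (v′ : List (Fin k)) → (pref u n ++ v′ ≡ pref u B) × IsPrefixOf y v′)
    × (length x ≡ length y)
    × (x ++ w ≡ pref u n ++ y)))
proposition3p2 u _ n B _ covers begins ends w =
  mk⇔ (factor⇒window u n B covers begins ends w) (window⇒factor u n B w)
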